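{- Let $L$ be a local field with residue characteristic $p$, valuation $v_L$, maximal ideal $\mathfrak{M}_L$ and $e_L=v_L(p)$. Let $\alpha\in L$ satisfy $v_L(\alpha)=-u$ with $0<u<e_L/(p-1)$, and let $\beta\in L$ be such that $\beta^p-\beta\equiv\alpha^p-\alpha\pmod{\mathfrak{M}_L}$. Then there is $k\in\mathbb{Z}$ such that $\beta\equiv\alpha+k\pmod{\mathfrak{M}_L}$.
   Context: A local field is a field complete with respect to a discrete valuation $v_L$ with $v_L(L^\times)=\mathbb{Z}$ and perfect residue field of characteristic $p$. $x\equiv y\pmod{\mathfrak{M}_L}$ means $v_L(x-y)>0$. -}

module Defs where

open import Level using (Level; _⊔_) renaming (suc to lsuc)
open import Algebra.Bundles using (CommutativeRing)
open import Data.Nat as ℕ using (ℕ; zero; suc)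
open import Data.Nat.Primality using (Prime)
open import Data.Integer as ℤ using (ℤ; +_; -[1+_])
open import Data.Product using (Σ; ∃; _×_; _,_)
open import Data.Sum using (_⊎_)
open import Relation.Nullary using (¬_)
open import Relation.Binary.PropositionalEquality using (_≡_)

data ℤ∞ : Set where
  fin : ℤ → ℤ∞
  ∞   : ℤ∞

data _≤∞_ : ℤ∞ → ℤ∞ → Set where
  fin≤fin : ∀ {a b} → a ℤ.≤ b → fin a ≤∞ fin b
  x≤∞     : ∀ {x} → x ≤∞ ∞

data _<∞_ : ℤ∞ → ℤ∞ → Set where
  fin<fin : ∀ {a b} → a ℤ.< b → fin a <∞ fin b
  fin<∞   : ∀ {a} → fin a <∞ ∞

_+∞_ : ℤ∞ → ℤ∞ → ℤ∞
fin a +∞ fin b = fin (a ℤ.+ b)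
fin a +∞ ∞     = ∞
∞     +∞ _     = ∞

module RingOps {c ℓ : Level} (R : CommutativeRing c ℓ) where
  open CommutativeRing R

  _^_ : Carrier → ℕ → Carrier
  x ^ zero  = 1#
  x ^ suc n = x * (x ^ n)

  ℕ→R : ℕ → Carrier
  ℕ→R zero    = 0#
  ℕ→R (suc n) = 1# + ℕ→R n

  ℤ→R : ℤ → Carrier
  ℤ→R (+ n)      = ℕ→R n
  ℤ→R -[1+ n ]   = - ℕ→R (suc n)

-- A local field: a field L, complete for a normalised discrete valuation
-- v_L : L → ℤ ∪ {∞} (v_L(L^×) = ℤ), whose residue field is perfect of
-- characteristic p (p prime).
record LocalField (c ℓ : Level) : Set (lsuc (c ⊔ ℓ)) where
  field
    cring : CommutativeRing c ℓ
  open CommutativeRing cring public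
  open RingOps cring public
  field
    1≉0      : ¬ (1# ≈ 0#)
    inverse  : ∀ x → ¬ (x ≈ 0#) → ∃ λ y → (x * y) ≈ 1#
    v        : Carrier → ℤ∞
    v-cong   : ∀ {x y} → x ≈ y → v x ≡ v y
    v-∞      : ∀ x → v x ≡ ∞ → x ≈ 0#
    v-0      : v 0# ≡ ∞
    v-mul    : ∀ x y → v (x * y) ≡ v x +∞ v y
    v-add    : ∀ x y → (v x ≤∞ v (x + y)) ⊎ (v y ≤∞ v (x + y))
    v-surj   : ∃ λ π → v π ≡ fin (+ 1)
    complete : (a : ℕ → Carrier) →
               (∀ (n : ℕ) → ∃ λ N → ∀ m k → N ℕ.≤ m → N ℕ.≤ k →
                   fin (+ n) ≤∞ v (a m - a k)) →
               ∃ λ l → ∀ (n : ℕ) → ∃ λ N → ∀ m → N ℕ.≤ m →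
                   fin (+ n) ≤∞ v (a m - l)
    p        : ℕ
    p-prime  : Prime p
    p-res    : fin (+ 0) <∞ v (ℕ→R p)
    -- residue field perfect: every residue class is a p-th power
    perfect  : ∀ x → fin (+ 0) ≤∞ v x →
               ∃ λ y → fin (+ 0) <∞ v ((y ^ p) - x)

  _≡[𝔐]_ : Carrier → Carrier → Set
  x ≡[𝔐] y = fin (+ 0) <∞ v (x - y)

  -- absolute ramification index e_L = v_L(p)  (∞ if char L = p)
  e : ℤ∞
  e = v (ℕ→R p)

-- Put γ = β - α and ℘ x = x ^ p - x. Since p divides C(p,i) for 0 < i < p and e_L > u(p-1),
-- the binomial expansion gives ℘(α + γ) ≡ ℘ α + ℘ γ modulo 𝔐^(1 + (p-1)t) for any t ≤ min(0, v γ),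
-- so ℘ γ ∈ 𝔐^(1 + (p-1)t). Taking t = v γ < 0 would contradict v(℘ γ) = p·v γ, hence γ is integral
-- and ℘ γ ∈ 𝔐. Modulo 𝔐, X^p - X factors as X(X-1)…(X-(p-1)) (synthetic division at the roots
-- 0, …, p-1 supplied by Fermat's little theorem), and 𝔐 is prime, so γ ≡ k for some 0 ≤ k < p.

{-# OPTIONS --safe #-}
module Submission where

open import Defs
open import Level using (Level; _⊔_; 0ℓ)
open import Algebra.Bundles using (CommutativeRing)
open import Data.Nat as ℕ using (ℕ; zero; suc; _∸_; _!)
import Data.Nat.Properties as ℕP
open import Data.Nat.Divisibility using (_∣_; divides; ∣⇒≤; ∣1⇒≡1; m∣m*n)
open import Data.Nat.DivMod using (m/n*n≡m)
open import Data.Nat.Primality using (Prime; euclidsLemma; ¬prime[0]; ¬prime[1])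
open import Data.Nat.Combinatorics using (_C_; nCn≡1; nCk≡n!/k![n-k]!; k![n∸k]!∣n!)
open import Data.Integer as ℤ using (ℤ; +_; -[1+_]; 0ℤ; 1ℤ)
import Data.Integer.Properties as ℤP
open import Data.Integer.Tactic.RingSolver using (solve-∀)
open import Data.Product using (∃; _×_; _,_; proj₁; proj₂)
open import Data.Sum using (_⊎_; inj₁; inj₂)
open import Data.Empty using (⊥; ⊥-elim)
open import Relation.Nullary using (¬_; contradiction)
open import Relation.Binary.PropositionalEquality as ≡ using (_≡_)

fin-injective : ∀ {a b} → fin a ≡ fin b → a ≡ b
fin-injective ≡.refl = ≡.refl

≤∞-trans : ∀ {x y z} → x ≤∞ y → y ≤∞ z → x ≤∞ z
≤∞-trans (fin≤fin a≤b) (fin≤fin b≤c) = fin≤fin (ℤP.≤-trans a≤b b≤c)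
≤∞-trans (fin≤fin _)   x≤∞           = x≤∞
≤∞-trans x≤∞           x≤∞           = x≤∞

+∞-mono-≤ : ∀ {a b x y} → fin a ≤∞ x → fin b ≤∞ y → fin (a ℤ.+ b) ≤∞ (x +∞ y)
+∞-mono-≤ (fin≤fin a≤x) (fin≤fin b≤y) = fin≤fin (ℤP.+-mono-≤ a≤x b≤y)
+∞-mono-≤ (fin≤fin _)   x≤∞           = x≤∞
+∞-mono-≤ x≤∞           _             = x≤∞

+∞-identityˡ : ∀ x → fin 0ℤ +∞ x ≡ x
+∞-identityˡ (fin a) = ≡.cong fin (ℤP.+-identityˡ a)
+∞-identityˡ ∞       = ≡.refl

x+∞x≡0⇒x≡0 : ∀ x → x +∞ x ≡ fin 0ℤ → x ≡ fin 0ℤ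
x+∞x≡0⇒x≡0 (fin (+ zero))  _  = ≡.refl
x+∞x≡0⇒x≡0 (fin (+ suc n)) ()
x+∞x≡0⇒x≡0 (fin -[1+ n ])  ()
x+∞x≡0⇒x≡0 ∞               ()

<∞⇒suc≤∞ : ∀ {n x} → fin n <∞ x → fin (ℤ.suc n) ≤∞ x
<∞⇒suc≤∞ (fin<fin n<a) = fin≤fin (ℤP.i<j⇒suc[i]≤j n<a)
<∞⇒suc≤∞ fin<∞         = x≤∞

suc≤∞⇒<∞ : ∀ {n x} → fin (ℤ.suc n) ≤∞ x → fin n <∞ x
suc≤∞⇒<∞ (fin≤fin 1+n≤a) = fin<fin (ℤP.suc[i]≤j⇒i<j 1+n≤a)
suc≤∞⇒<∞ x≤∞             = fin<∞

pos-+∞⇒pos⊎pos : ∀ {x y} → fin 0ℤ ≤∞ x → fin 0ℤ ≤∞ y → fin 1ℤ ≤∞ (x +∞ y) →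
                 fin 1ℤ ≤∞ x ⊎ fin 1ℤ ≤∞ y
pos-+∞⇒pos⊎pos {∞}               _           _ _ = inj₁ x≤∞
pos-+∞⇒pos⊎pos {fin _}       {∞} _           _ _ = inj₂ x≤∞
pos-+∞⇒pos⊎pos {fin (+ suc _)}   _           _ _ = inj₁ (fin≤fin (ℤ.+≤+ (ℕ.s≤s ℕ.z≤n)))
pos-+∞⇒pos⊎pos {fin (+ zero)} {fin b} _ _ (fin≤fin 1≤0+b) =
  inj₂ (fin≤fin (≡.subst (1ℤ ℤ.≤_) (ℤP.+-identityˡ b) 1≤0+b))
pos-+∞⇒pos⊎pos {fin -[1+ _ ]}    (fin≤fin ()) _ _

C*k!*[n∸k]!≡n! : ∀ {n k} → k ℕ.≤ n → (n C k) ℕ.* (k ! ℕ.* (n ∸ k) !) ≡ n !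
C*k!*[n∸k]!≡n! {n} {k} k≤n = ≡.trans
  (≡.cong (ℕ._* (k ! ℕ.* (n ∸ k) !)) (nCk≡n!/k![n-k]! k≤n))
  (m/n*n≡m {{k ℕP.!* (n ∸ k) !≢0}} (k![n∸k]!∣n! k≤n))

prime∤! : ∀ {P m} → Prime P → m ℕ.< P → ¬ P ∣ m !
prime∤! {m = zero}  pr _   P∣1  = ¬prime[1] (≡.subst Prime (∣1⇒≡1 P∣1) pr)
prime∤! {m = suc m} pr m<P P∣m! with euclidsLemma (suc m) (m !) pr P∣m!
... | inj₁ P∣1+m = ℕP.<⇒≱ m<P (∣⇒≤ P∣1+m)
... | inj₂ P∣m!′ = prime∤! pr (ℕP.<-trans (ℕP.n<1+n m) m<P) P∣m!′

prime∣C : ∀ {P k} → Prime P → 0 ℕ.< k → k ℕ.< P → P ∣ P C k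
prime∣C {zero}      pr = contradiction pr ¬prime[0]
prime∣C {P@(suc q)} {k} pr 0<k k<P
  with euclidsLemma (P C k) (k ! ℕ.* (P ∸ k) !) pr
         (≡.subst (P ∣_) (≡.sym (C*k!*[n∸k]!≡n! (ℕP.<⇒≤ k<P))) (m∣m*n (q !)))
... | inj₁ P∣C = P∣C
... | inj₂ P∣k!*[P∸k]! with euclidsLemma (k !) ((P ∸ k) !) pr P∣k!*[P∸k]!
...   | inj₁ P∣k!     = contradiction P∣k! (prime∤! pr k<P)
...   | inj₂ P∣[P∸k]! = contradiction P∣[P∸k]! (prime∤! pr (ℕP.∸-monoʳ-< 0<k (ℕP.<⇒≤ k<P)))

prime⇒≡2+∸2 : ∀ {P} → Prime P → P ≡ 2 ℕ.+ (P ∸ 2)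
prime⇒≡2+∸2 {0}           pr = contradiction pr ¬prime[0]
prime⇒≡2+∸2 {1}           pr = contradiction pr ¬prime[1]
prime⇒≡2+∸2 {suc (suc _)} _  = ≡.refl

1+uq+[q*-u+q*t]≡1+q*t : ∀ u q t →
  ℤ.suc (+ (u ℕ.* q)) ℤ.+ (+ q ℤ.* ℤ.- + u ℤ.+ + q ℤ.* t) ≡ 1ℤ ℤ.+ + q ℤ.* t
1+uq+[q*-u+q*t]≡1+q*t u q t =
  ≡.trans (≡.cong (λ uq → ℤ.suc uq ℤ.+ (+ q ℤ.* ℤ.- + u ℤ.+ + q ℤ.* t)) (ℤP.pos-* u q))
          (cancel (+ u) (+ q) t)
  where
  cancel : ∀ U Q T → (1ℤ ℤ.+ U ℤ.* Q) ℤ.+ (Q ℤ.* ℤ.- U ℤ.+ Q ℤ.* T) ≡ 1ℤ ℤ.+ Q ℤ.* T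
  cancel = solve-∀

nonNeg*nonPos≤0 : ∀ q {t} → t ℤ.≤ 0ℤ → + q ℤ.* t ℤ.≤ 0ℤ
nonNeg*nonPos≤0 q {t} t≤0 =
  ≡.subst (+ q ℤ.* t ℤ.≤_) (ℤP.*-zeroʳ (+ q)) (ℤP.*-monoˡ-≤-nonNeg (+ q) t≤0)

1+[1+q]n≤1+qn : ∀ q {n} → n ℤ.≤ 0ℤ → 1ℤ ℤ.+ + suc q ℤ.* n ℤ.≤ 1ℤ ℤ.+ + q ℤ.* n
1+[1+q]n≤1+qn q {n} n≤0 = ℤP.+-monoʳ-≤ 1ℤ (begin
  + suc q ℤ.* n    ≡⟨ ℤP.suc-* (+ q) n ⟩
  n ℤ.+ + q ℤ.* n  ≤⟨ ℤP.+-monoˡ-≤ (+ q ℤ.* n) n≤0 ⟩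
  0ℤ ℤ.+ + q ℤ.* n ≡⟨ ℤP.+-identityˡ (+ q ℤ.* n) ⟩
  + q ℤ.* n        ∎)
  where open ℤP.≤-Reasoning

1+[2+q]n≤n : ∀ q {n} → n ℤ.< 0ℤ → 1ℤ ℤ.+ + (2 ℕ.+ q) ℤ.* n ℤ.≤ n
1+[2+q]n≤n q {n} n<0 = begin
  1ℤ ℤ.+ + (2 ℕ.+ q) ℤ.* n     ≡⟨ ≡.cong ℤ.suc (ℤP.suc-* (+ suc q) n) ⟩
  1ℤ ℤ.+ (n ℤ.+ + suc q ℤ.* n) ≡⟨ shuffle n (+ suc q ℤ.* n) ⟩
  n ℤ.+ (1ℤ ℤ.+ + suc q ℤ.* n) ≤⟨ ℤP.+-monoʳ-≤ n (ℤP.i<j⇒suc[i]≤j [1+q]n<0) ⟩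
  n ℤ.+ 0ℤ                     ≡⟨ ℤP.+-identityʳ n ⟩
  n                            ∎
  where
  open ℤP.≤-Reasoning
  [1+q]n<0 : + suc q ℤ.* n ℤ.< 0ℤ
  [1+q]n<0 = ≡.subst (+ suc q ℤ.* n ℤ.<_) (ℤP.*-zeroʳ (+ suc q)) (ℤP.*-monoˡ-<-pos (+ suc q) n<0)
  shuffle : ∀ N Q → 1ℤ ℤ.+ (N ℤ.+ Q) ≡ N ℤ.+ (1ℤ ℤ.+ Q)
  shuffle = solve-∀

module MonicPolynomial {c ℓ : Level} (R : CommutativeRing c ℓ) where
  open CommutativeRing R
  open RingOps R
  open import Algebra.Properties.Ring ring using (x[y-z]≈xy-xz)
  open import Algebra.Properties.AbelianGroup +-abelianGroup using (//-rightDividesˡ)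
  open import Algebra.Properties.CommutativeSemigroup *-commutativeSemigroup using (x∙yz≈y∙xz)
  open import Relation.Binary.Reasoning.Setoid setoid

  data Monic : ℕ → (Carrier → Carrier) → Set (c ⊔ ℓ) where
    one    : ∀ {f} → (∀ x → f x ≈ 1#) → Monic 0 f
    horner : ∀ {d f} g a → Monic d g → (∀ x → f x ≈ x * g x + a) → Monic (suc d) f

  x*q≈[x-c]*q+c*q : ∀ x c q → x * q ≈ (x - c) * q + c * q
  x*q≈[x-c]*q+c*q x c q = begin
    x * q               ≈⟨ *-congʳ (//-rightDividesˡ c x) ⟨
    ((x - c) + c) * q   ≈⟨ distribʳ q (x - c) c ⟩
    (x - c) * q + c * q ∎

  x*[[x-c]*h+b]≈[x-c]*[x*h+b]+c*b : ∀ x c h b →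
    x * ((x - c) * h + b) ≈ (x - c) * (x * h + b) + c * b
  x*[[x-c]*h+b]≈[x-c]*[x*h+b]+c*b x c h b = begin
    x * ((x - c) * h + b)                     ≈⟨ distribˡ x _ _ ⟩
    x * ((x - c) * h) + x * b                 ≈⟨ +-cong (x∙yz≈y∙xz x (x - c) h) (x*q≈[x-c]*q+c*q x c b) ⟩
    (x - c) * (x * h) + ((x - c) * b + c * b) ≈⟨ +-assoc _ _ _ ⟨
    ((x - c) * (x * h) + (x - c) * b) + c * b ≈⟨ +-congʳ (distribˡ (x - c) _ _) ⟨
    (x - c) * (x * h + b) + c * b             ∎

  divide : ∀ {d f} → Monic (suc d) f → ∀ c →
           ∃ λ g → Monic d g × (∀ x → f x ≈ (x - c) * g x + f c)
  divide {f = f} (horner g a (one g≈1) f≈) c = g , one g≈1 , λ x → begin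
    f x                           ≈⟨ f≈ x ⟩
    x * g x + a                   ≈⟨ +-congʳ (x*q≈[x-c]*q+c*q x c (g x)) ⟩
    ((x - c) * g x + c * g x) + a ≈⟨ +-assoc _ _ _ ⟩
    (x - c) * g x + (c * g x + a) ≈⟨ +-congˡ (+-congʳ (*-congˡ (trans (g≈1 x) (sym (g≈1 c))))) ⟩
    (x - c) * g x + (c * g c + a) ≈⟨ +-congˡ (f≈ c) ⟨
    (x - c) * g x + f c           ∎
  divide {f = f} (horner g a g-monic@(horner _ _ _ _) f≈) c with divide g-monic c
  ... | h , h-monic , g≈ = (λ x → x * h x + g c) , horner h (g c) h-monic (λ _ → refl) , λ x → begin
    f x                                       ≈⟨ f≈ x ⟩
    x * g x + a                               ≈⟨ +-congʳ (*-congˡ (g≈ x)) ⟩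
    x * ((x - c) * h x + g c) + a             ≈⟨ +-congʳ (x*[[x-c]*h+b]≈[x-c]*[x*h+b]+c*b x c (h x) (g c)) ⟩
    ((x - c) * (x * h x + g c) + c * g c) + a ≈⟨ +-assoc _ _ _ ⟩
    (x - c) * (x * h x + g c) + (c * g c + a) ≈⟨ +-congˡ (f≈ c) ⟨
    (x - c) * (x * h x + g c) + f c           ∎

  ^-monic : ∀ n → Monic n (_^ n)
  ^-monic zero    = one (λ _ → refl)
  ^-monic (suc n) = horner (_^ n) 0# (^-monic n) (λ _ → sym (+-identityʳ _))

  x^[2+r]-x-monic : ∀ r → Monic (2 ℕ.+ r) (λ x → x ^ (2 ℕ.+ r) - x)
  x^[2+r]-x-monic r =
    horner (λ x → x ^ suc r - 1#) 0# (horner (_^ r) (- 1#) (^-monic r) (λ _ → refl)) factor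
    where
    factor : ∀ x → x ^ (2 ℕ.+ r) - x ≈ x * (x ^ suc r - 1#) + 0#
    factor x = begin
      x * x ^ suc r - x           ≈⟨ +-congˡ (-‿cong (*-identityʳ x)) ⟨
      x * x ^ suc r - x * 1#      ≈⟨ x[y-z]≈xy-xz x _ _ ⟨
      x * (x ^ suc r - 1#)        ≈⟨ +-identityʳ _ ⟨
      x * (x ^ suc r - 1#) + 0#   ∎

module BinomialSplit {c ℓ : Level} (R : CommutativeRing c ℓ) where
  open CommutativeRing R
  open RingOps R
  open import Algebra.Definitions.RawMonoid +-rawMonoid using (sum) renaming (_×_ to _·_)
  open import Algebra.Properties.Monoid.Sum +-monoid using (sum-init-last)
  open import Algebra.Properties.Semiring.Exp semiring using () renaming (_^_ to _^ᵐ_)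
  import Algebra.Properties.CommutativeSemiring.Binomial commutativeSemiring as Binomial
  open import Data.Fin using (Fin; toℕ; inject₁; fromℕ)
  import Data.Fin as Fin
  open import Data.Fin.Properties using (toℕ-fromℕ)
  open import Relation.Binary.Reasoning.Setoid setoid

  ^≡^ᵐ : ∀ x n → x ^ n ≡ x ^ᵐ n
  ^≡^ᵐ x zero    = ≡.refl
  ^≡^ᵐ x (suc n) = ≡.cong (x *_) (^≡^ᵐ x n)

  middleBinomialTerms : Carrier → Carrier → ℕ → Carrier
  middleBinomialTerms a b q =
    sum (λ (j : Fin q) → Binomial.binomialTerm a b (suc q) (Fin.suc (inject₁ j)))

  binomial-split : ∀ a b q → (a + b) ^ suc q ≈ b ^ suc q + (middleBinomialTerms a b q + a ^ suc q)
  binomial-split a b q = begin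
    (a + b) ^ P                              ≡⟨ ^≡^ᵐ (a + b) P ⟩
    (a + b) ^ᵐ P                             ≈⟨ Binomial.theorem P a b ⟩
    T Fin.zero + sum (λ j → T (Fin.suc j))   ≈⟨ +-cong first-term (sum-init-last (λ j → T (Fin.suc j))) ⟩
    b ^ P + (middle + T (Fin.suc (fromℕ q))) ≈⟨ +-congˡ (+-congˡ (last-term _ (toℕ-fromℕ q))) ⟩
    b ^ P + (middle + a ^ P)                 ∎
    where
    P : ℕ
    P = suc q
    T : Fin (suc P) → Carrier
    T = Binomial.binomialTerm a b P
    middle : Carrier
    middle = middleBinomialTerms a b q

    first-term : T Fin.zero ≈ b ^ P
    first-term = trans (+-identityʳ _) (trans (*-identityˡ _) (reflexive (≡.sym (^≡^ᵐ b P))))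

    last-term : ∀ k → k ≡ q → (P C suc k) · (a ^ᵐ suc k * b ^ᵐ (q ∸ k)) ≈ a ^ P
    last-term k ≡.refl = begin
      (P C P) · (a ^ᵐ P * b ^ᵐ (q ∸ q)) ≡⟨ ≡.cong₂ (λ n e → n · (a ^ᵐ P * b ^ᵐ e)) (nCn≡1 P) (ℕP.n∸n≡0 q) ⟩
      1 · (a ^ᵐ P * 1#)                 ≈⟨ trans (+-identityʳ _) (*-identityʳ _) ⟩
      a ^ᵐ P                            ≡⟨ ≡.sym (^≡^ᵐ a P) ⟩
      a ^ P                             ∎

module Valuation {c ℓ : Level} (L : LocalField c ℓ) where
  open LocalField L
  open import Algebra.Properties.Ring ring using (-1*x≈-x; x[y-z]≈xy-xz)
  open import Algebra.Properties.AbelianGroup +-abelianGroup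
    using (⁻¹-involutive; ⁻¹-anti-homo‿-; ⁻¹-∙-comm; xyx⁻¹≈y; x≈y⇒x∙y⁻¹≈ε;
           //-rightDividesˡ; //-rightDividesʳ)
  open import Algebra.Properties.CommutativeSemigroup +-commutativeSemigroup using (interchange; x∙yz≈xz∙y)
  open import Algebra.Properties.AbelianGroup ℤP.+-0-abelianGroup using (identityˡ-unique)
  open import Algebra.Definitions.RawMonoid +-rawMonoid using (sum) renaming (_×_ to _·_)
  open import Algebra.Properties.Monoid.Mult +-monoid using (×-assocˡ)
  open import Algebra.Properties.Semiring.Exp semiring using () renaming (_^_ to _^ᵐ_)
  open BinomialSplit cring
  import Data.Fin.Properties as FinP
  open import Data.Fin using (Fin)
  import Data.Fin as Fin
  open import Data.Nat.Coprimality using (coprime-Bézout; prime⇒coprime)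
  open import Data.Nat.GCD using (module Bézout)
  open import Relation.Binary.Bundles using (Setoid)
  import Relation.Binary.Reasoning.Setoid as SetoidReasoning
  module ≈-Reasoning = SetoidReasoning setoid

  infix 4 _∈𝔐^_ _≡[𝔐^_]_

  _∈𝔐^_ : Carrier → ℤ → Set
  x ∈𝔐^ n = fin n ≤∞ v x

  _≡[𝔐^_]_ : Carrier → ℤ → Carrier → Set
  x ≡[𝔐^ n ] y = x - y ∈𝔐^ n

  v-1 : v 1# ≡ fin 0ℤ
  v-1 with v 1# in eq
  ... | ∞     = ⊥-elim (1≉0 (v-∞ 1# eq))
  ... | fin a = ≡.cong fin (identityˡ-unique a a (fin-injective (≡.sym a≡a+a)))
    where
    a≡a+a : fin a ≡ fin (a ℤ.+ a)
    a≡a+a = ≡.trans (≡.sym eq)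
      (≡.trans (v-cong (sym (*-identityˡ 1#))) (≡.trans (v-mul 1# 1#) (≡.cong₂ _+∞_ eq eq)))

  v-neg : ∀ x → v (- x) ≡ v x
  v-neg x = ≡.trans (v-cong (sym (-1*x≈-x x)))
    (≡.trans (v-mul (- 1#) x) (≡.trans (≡.cong (_+∞ v x) v[-1]≡0) (+∞-identityˡ (v x))))
    where
    v[-1]≡0 : v (- 1#) ≡ fin 0ℤ
    v[-1]≡0 = x+∞x≡0⇒x≡0 (v (- 1#))
      (≡.trans (≡.sym (v-mul (- 1#) (- 1#)))
        (≡.trans (v-cong (trans (-1*x≈-x (- 1#)) (⁻¹-involutive 1#))) v-1))

  ∈𝔐^-resp-≈ : ∀ {n x y} → x ≈ y → x ∈𝔐^ n → y ∈𝔐^ n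
  ∈𝔐^-resp-≈ {n} x≈y = ≡.subst (fin n ≤∞_) (v-cong x≈y)

  ∈𝔐^-weaken : ∀ {m n x} → m ℤ.≤ n → x ∈𝔐^ n → x ∈𝔐^ m
  ∈𝔐^-weaken m≤n = ≤∞-trans (fin≤fin m≤n)

  v≡⇒∈𝔐^ : ∀ {n x} → v x ≡ fin n → x ∈𝔐^ n
  v≡⇒∈𝔐^ {n} vx≡n = ≡.subst (fin n ≤∞_) (≡.sym vx≡n) (fin≤fin ℤP.≤-refl)

  v≡⇒∉𝔐^suc : ∀ {n x} → v x ≡ fin n → ¬ x ∈𝔐^ ℤ.suc n
  v≡⇒∉𝔐^suc {n} vx≡n x∈ with ≡.subst (fin (ℤ.suc n) ≤∞_) vx≡n x∈
  ... | fin≤fin 1+n≤n = ℤP.<-irrefl ≡.refl (ℤP.suc[i]≤j⇒i<j 1+n≤n)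

  0∈𝔐^ : ∀ {n} → 0# ∈𝔐^ n
  0∈𝔐^ {n} = ≡.subst (fin n ≤∞_) (≡.sym v-0) x≤∞

  1∈𝔐^0 : 1# ∈𝔐^ 0ℤ
  1∈𝔐^0 = v≡⇒∈𝔐^ v-1

  1∉𝔐 : ¬ 1# ∈𝔐^ 1ℤ
  1∉𝔐 = v≡⇒∉𝔐^suc v-1

  +-∈𝔐^ : ∀ {n x y} → x ∈𝔐^ n → y ∈𝔐^ n → x + y ∈𝔐^ n
  +-∈𝔐^ {x = x} {y} x∈ y∈ with v-add x y
  ... | inj₁ vx≤v[x+y] = ≤∞-trans x∈ vx≤v[x+y]
  ... | inj₂ vy≤v[x+y] = ≤∞-trans y∈ vy≤v[x+y]

  -‿∈𝔐^ : ∀ {n x} → x ∈𝔐^ n → - x ∈𝔐^ n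
  -‿∈𝔐^ {n} {x} = ≡.subst (fin n ≤∞_) (≡.sym (v-neg x))

  -∈𝔐^ : ∀ {n x y} → x ∈𝔐^ n → y ∈𝔐^ n → x - y ∈𝔐^ n
  -∈𝔐^ x∈ y∈ = +-∈𝔐^ x∈ (-‿∈𝔐^ y∈)

  *-∈𝔐^ : ∀ {m n x y} → x ∈𝔐^ m → y ∈𝔐^ n → x * y ∈𝔐^ (m ℤ.+ n)
  *-∈𝔐^ {m} {n} {x} {y} x∈ y∈ =
    ≡.subst (fin (m ℤ.+ n) ≤∞_) (≡.sym (v-mul x y)) (+∞-mono-≤ x∈ y∈)

  *-∈𝔐^-integralˡ : ∀ {n x y} → x ∈𝔐^ 0ℤ → y ∈𝔐^ n → x * y ∈𝔐^ n
  *-∈𝔐^-integralˡ {n} {x} {y} x∈ y∈ =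
    ≡.subst (λ m → x * y ∈𝔐^ m) (ℤP.+-identityˡ n) (*-∈𝔐^ x∈ y∈)

  ^-∈𝔐^ : ∀ {n x} k → x ∈𝔐^ n → x ^ k ∈𝔐^ (+ k ℤ.* n)
  ^-∈𝔐^         zero    _  = 1∈𝔐^0
  ^-∈𝔐^ {n} {x} (suc k) x∈ =
    ≡.subst (λ m → x ^ suc k ∈𝔐^ m) (≡.sym (ℤP.suc-* (+ k) n)) (*-∈𝔐^ x∈ (^-∈𝔐^ k x∈))

  ^-∈𝔐^-nonPos : ∀ {s x k} q → x ∈𝔐^ s → s ℤ.≤ 0ℤ → k ℕ.≤ q → x ^ k ∈𝔐^ (+ q ℤ.* s)
  ^-∈𝔐^-nonPos {s} {k = k} q x∈ s≤0 k≤q =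
    ∈𝔐^-weaken (ℤP.*-monoʳ-≤-nonPos s {{ℤ.nonPositive s≤0}} (ℤ.+≤+ k≤q)) (^-∈𝔐^ k x∈)

  v-^ : ∀ {n x} k → v x ≡ fin n → v (x ^ k) ≡ fin (+ k ℤ.* n)
  v-^         zero    _     = v-1
  v-^ {n} {x} (suc k) vx≡n = ≡.trans (v-mul x (x ^ k))
    (≡.trans (≡.cong₂ _+∞_ vx≡n (v-^ k vx≡n)) (≡.cong fin (≡.sym (ℤP.suc-* (+ k) n))))

  ·-∈𝔐^ : ∀ {n x} k → x ∈𝔐^ n → k · x ∈𝔐^ n
  ·-∈𝔐^ zero    _  = 0∈𝔐^
  ·-∈𝔐^ (suc k) x∈ = +-∈𝔐^ x∈ (·-∈𝔐^ k x∈)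

  sum-∈𝔐^ : ∀ {m n} (f : Fin m → Carrier) → (∀ i → f i ∈𝔐^ n) → sum f ∈𝔐^ n
  sum-∈𝔐^ {zero}  f _  = 0∈𝔐^
  sum-∈𝔐^ {suc m} f f∈ =
    +-∈𝔐^ (f∈ Fin.zero) (sum-∈𝔐^ (λ i → f (Fin.suc i)) (λ i → f∈ (Fin.suc i)))

  ℕ→R≡·1 : ∀ n → ℕ→R n ≡ n · 1#
  ℕ→R≡·1 zero    = ≡.refl
  ℕ→R≡·1 (suc n) = ≡.cong (λ x → 1# + x) (ℕ→R≡·1 n)

  ℕ→R-+ : ∀ m n → ℕ→R (m ℕ.+ n) ≈ ℕ→R m + ℕ→R n
  ℕ→R-+ zero    n = sym (+-identityˡ _)
  ℕ→R-+ (suc m) n = trans (+-congˡ (ℕ→R-+ m n)) (sym (+-assoc _ _ _))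

  ℕ→R-∈𝔐^0 : ∀ n → ℕ→R n ∈𝔐^ 0ℤ
  ℕ→R-∈𝔐^0 n = ≡.subst (_∈𝔐^ 0ℤ) (≡.sym (ℕ→R≡·1 n)) (·-∈𝔐^ n 1∈𝔐^0)

  ℕ→R-*-∈𝔐^ : ∀ {k} m n → ℕ→R n ∈𝔐^ k → ℕ→R (m ℕ.* n) ∈𝔐^ k
  ℕ→R-*-∈𝔐^ {k} m n n∈ = ≡.subst (_∈𝔐^ k) (≡.sym (ℕ→R≡·1 (m ℕ.* n)))
    (∈𝔐^-resp-≈ (×-assocˡ 1# m n) (·-∈𝔐^ m (≡.subst (_∈𝔐^ k) (ℕ→R≡·1 n) n∈)))

  𝔐-prime : ∀ {x y} → x ∈𝔐^ 0ℤ → y ∈𝔐^ 0ℤ → x * y ∈𝔐^ 1ℤ → x ∈𝔐^ 1ℤ ⊎ y ∈𝔐^ 1ℤ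
  𝔐-prime {x} {y} x∈ y∈ xy∈ =
    pos-+∞⇒pos⊎pos x∈ y∈ (≡.subst (fin 1ℤ ≤∞_) (v-mul x y) xy∈)

  unit-cancelˡ : ∀ {n u x} → v u ≡ fin 0ℤ → u * x ∈𝔐^ n → x ∈𝔐^ n
  unit-cancelˡ {n} {u} {x} vu≡0 = ≡.subst (fin n ≤∞_)
    (≡.trans (v-mul u x) (≡.trans (≡.cong (_+∞ v x) vu≡0) (+∞-identityˡ (v x))))

  integral-∉𝔐⇒unit : ∀ {x} → x ∈𝔐^ 0ℤ → ¬ x ∈𝔐^ 1ℤ → v x ≡ fin 0ℤ
  integral-∉𝔐⇒unit {x} x∈ x∉ with v x
  ... | ∞             = contradiction x≤∞ x∉
  ... | fin (+ zero)  = ≡.refl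
  ... | fin (+ suc k) = contradiction (fin≤fin (ℤ.+≤+ (ℕ.s≤s ℕ.z≤n))) x∉
  integral-∉𝔐⇒unit (fin≤fin ()) _ | fin -[1+ k ]

  ≈⇒≡[𝔐^] : ∀ {n x y} → x ≈ y → x ≡[𝔐^ n ] y
  ≈⇒≡[𝔐^] x≈y = ∈𝔐^-resp-≈ (sym (x≈y⇒x∙y⁻¹≈ε x≈y)) 0∈𝔐^

  ≡[𝔐^]-sym : ∀ {n x y} → x ≡[𝔐^ n ] y → y ≡[𝔐^ n ] x
  ≡[𝔐^]-sym {x = x} {y} x≡y = ∈𝔐^-resp-≈ (⁻¹-anti-homo‿- x y) (-‿∈𝔐^ x≡y)

  ≡[𝔐^]-trans : ∀ {n x y z} → x ≡[𝔐^ n ] y → y ≡[𝔐^ n ] z → x ≡[𝔐^ n ] z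
  ≡[𝔐^]-trans {x = x} {y} {z} x≡y y≡z = ∈𝔐^-resp-≈ telescope (+-∈𝔐^ x≡y y≡z)
    where
    open ≈-Reasoning
    telescope : (x - y) + (y - z) ≈ x - z
    telescope = begin
      (x - y) + (y - z)   ≈⟨ +-assoc x (- y) (y - z) ⟩
      x + (- y + (y - z)) ≈⟨ +-congˡ (+-assoc (- y) y (- z)) ⟨
      x + ((- y + y) - z) ≈⟨ +-congˡ (+-congʳ (-‿inverseˡ y)) ⟩
      x + (0# - z)        ≈⟨ +-congˡ (+-identityˡ (- z)) ⟩
      x - z               ∎

  ≡[𝔐^]-setoid : ℤ → Setoid c 0ℓ
  ≡[𝔐^]-setoid n = record
    { Carrier       = Carrier
    ; _≈_           = _≡[𝔐^ n ]_
    ; isEquivalence = record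
      { refl  = ≈⇒≡[𝔐^] refl
      ; sym   = ≡[𝔐^]-sym
      ; trans = ≡[𝔐^]-trans
      }
    }

  module ≡[𝔐^]-Reasoning (n : ℤ) = SetoidReasoning (≡[𝔐^]-setoid n)

  ∈𝔐^-resp-≡[𝔐^] : ∀ {n x y} → x ≡[𝔐^ n ] y → y ∈𝔐^ n → x ∈𝔐^ n
  ∈𝔐^-resp-≡[𝔐^] {x = x} {y} x≡y y∈ = ∈𝔐^-resp-≈ (//-rightDividesˡ y x) (+-∈𝔐^ x≡y y∈)

  [x+y]-[z+w]≈[x-z]+[y-w] : ∀ x y z w → (x + y) - (z + w) ≈ (x - z) + (y - w)
  [x+y]-[z+w]≈[x-z]+[y-w] x y z w =
    trans (+-congˡ (sym (⁻¹-∙-comm z w))) (interchange x y (- z) (- w))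

  +-cong-≡[𝔐^] : ∀ {n x y z w} → x ≡[𝔐^ n ] z → y ≡[𝔐^ n ] w → x + y ≡[𝔐^ n ] z + w
  +-cong-≡[𝔐^] {x = x} {y} {z} {w} x≡z y≡w =
    ∈𝔐^-resp-≈ (sym ([x+y]-[z+w]≈[x-z]+[y-w] x y z w)) (+-∈𝔐^ x≡z y≡w)

  *-congˡ-≡[𝔐^] : ∀ {n a x y} → a ∈𝔐^ 0ℤ → x ≡[𝔐^ n ] y → a * x ≡[𝔐^ n ] a * y
  *-congˡ-≡[𝔐^] {a = a} {x} {y} a∈ x≡y =
    ∈𝔐^-resp-≈ (x[y-z]≈xy-xz a x y) (*-∈𝔐^-integralˡ a∈ x≡y)

  +-absorbʳ : ∀ {n x y} → y ∈𝔐^ n → x + y ≡[𝔐^ n ] x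
  +-absorbʳ {x = x} {y} = ∈𝔐^-resp-≈ (sym (xyx⁻¹≈y x y))

  +-absorbʳ⁻¹ : ∀ {n x y} → x + y ≡[𝔐^ n ] x → y ∈𝔐^ n
  +-absorbʳ⁻¹ {x = x} {y} = ∈𝔐^-resp-≈ (xyx⁻¹≈y x y)

  1+x*a≢y*b : ∀ {a b} x y → ℕ→R a ∈𝔐^ 1ℤ → ℕ→R b ∈𝔐^ 1ℤ → 1 ℕ.+ x ℕ.* a ≡ y ℕ.* b → ⊥
  1+x*a≢y*b {a} {b} x y a∈ b∈ eq = 1∉𝔐 (∈𝔐^-resp-≈ (//-rightDividesʳ (ℕ→R (x ℕ.* a)) 1#)
    (-∈𝔐^ (≡.subst (λ k → ℕ→R k ∈𝔐^ 1ℤ) (≡.sym eq) (ℕ→R-*-∈𝔐^ y b b∈)) (ℕ→R-*-∈𝔐^ x a a∈)))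

  p∈𝔐 : ℕ→R p ∈𝔐^ 1ℤ
  p∈𝔐 = <∞⇒suc≤∞ p-res

  ℕ→R-unit : ∀ {j} → 0 ℕ.< j → j ℕ.< p → v (ℕ→R j) ≡ fin 0ℤ
  ℕ→R-unit {suc j} _ j<p = integral-∉𝔐⇒unit (ℕ→R-∈𝔐^0 (suc j)) j∉𝔐
    where
    j∉𝔐 : ¬ ℕ→R (suc j) ∈𝔐^ 1ℤ
    j∉𝔐 j∈ with coprime-Bézout (prime⇒coprime p-prime j<p)
    ... | Bézout.+- x y eq = 1+x*a≢y*b y x j∈ p∈𝔐 eq
    ... | Bézout.-+ x y eq = 1+x*a≢y*b x y p∈𝔐 j∈ eq

  n·x≈ℕ→R[n]*x : ∀ n x → n · x ≈ ℕ→R n * x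
  n·x≈ℕ→R[n]*x zero    x = sym (zeroˡ x)
  n·x≈ℕ→R[n]*x (suc n) x =
    trans (+-cong (sym (*-identityˡ x)) (n·x≈ℕ→R[n]*x n x)) (sym (distribʳ x 1# (ℕ→R n)))

  frobenius : ∀ {P E s t a b} → Prime P → ℕ→R P ∈𝔐^ E → a ∈𝔐^ s → b ∈𝔐^ t →
              s ℤ.≤ 0ℤ → t ℤ.≤ 0ℤ →
              (a + b) ^ P ≡[𝔐^ E ℤ.+ (+ (P ∸ 1) ℤ.* s ℤ.+ + (P ∸ 1) ℤ.* t) ] a ^ P + b ^ P
  frobenius {zero} pr = contradiction pr ¬prime[0]
  frobenius {P@(suc q)} {E} {s} {t} {a} {b} pr P∈ a∈ b∈ s≤0 t≤0 = begin
    (a + b) ^ P                                 ≈⟨ ≈⇒≡[𝔐^] (binomial-split a b q) ⟩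
    b ^ P + (middleBinomialTerms a b q + a ^ P) ≈⟨ ≈⇒≡[𝔐^] (x∙yz≈xz∙y _ _ _) ⟩
    (b ^ P + a ^ P) + middleBinomialTerms a b q ≈⟨ +-absorbʳ middle∈ ⟩
    b ^ P + a ^ P                               ≈⟨ ≈⇒≡[𝔐^] (+-comm _ _) ⟩
    a ^ P + b ^ P                               ∎
    where
    open ≡[𝔐^]-Reasoning (E ℤ.+ (+ q ℤ.* s ℤ.+ + q ℤ.* t))

    middle-term∈ : ∀ i → i ℕ.< q →
                   (P C suc i) · (a ^ᵐ suc i * b ^ᵐ (q ∸ i)) ∈𝔐^ E ℤ.+ (+ q ℤ.* s ℤ.+ + q ℤ.* t)
    middle-term∈ i i<q with prime∣C pr (ℕ.s≤s ℕ.z≤n) (ℕ.s≤s i<q)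
    ... | divides m C≡m*P =
      ≡.subst (λ k → k · w ∈𝔐^ _) (≡.sym C≡m*P)
        (∈𝔐^-resp-≈ (×-assocˡ w m P)
          (·-∈𝔐^ m (∈𝔐^-resp-≈ (sym (n·x≈ℕ→R[n]*x P w)) (*-∈𝔐^ P∈ w∈))))
      where
      w : Carrier
      w = a ^ᵐ suc i * b ^ᵐ (q ∸ i)
      w∈ : w ∈𝔐^ (+ q ℤ.* s ℤ.+ + q ℤ.* t)
      w∈ = *-∈𝔐^ (≡.subst (_∈𝔐^ _) (^≡^ᵐ a (suc i)) (^-∈𝔐^-nonPos q a∈ s≤0 i<q))
                 (≡.subst (_∈𝔐^ _) (^≡^ᵐ b (q ∸ i)) (^-∈𝔐^-nonPos q b∈ t≤0 (ℕP.m∸n≤m q i)))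

    middle∈ : middleBinomialTerms a b q ∈𝔐^ E ℤ.+ (+ q ℤ.* s ℤ.+ + q ℤ.* t)
    middle∈ = sum-∈𝔐^ _ (λ j → middle-term∈ (Fin.toℕ (Fin.inject₁ j)) (FinP.inject₁ℕ< j))

module ArtinSchreier {c ℓ : Level} (L : LocalField c ℓ) where
  open LocalField L
  open Valuation L
  open MonicPolynomial cring
  open import Algebra.Properties.AbelianGroup +-abelianGroup using (//-rightDividesˡ; //-rightDividesʳ)

  ^-congˡ : ∀ {x y} n → x ≈ y → x ^ n ≈ y ^ n
  ^-congˡ zero    _   = refl
  ^-congˡ (suc n) x≈y = *-cong x≈y (^-congˡ n x≈y)

  ℘ : Carrier → Carrier
  ℘ x = x ^ p - x

  ℘-cong : ∀ {x y} → x ≈ y → ℘ x ≈ ℘ y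
  ℘-cong x≈y = +-cong (^-congˡ p x≈y) (-‿cong x≈y)

  ℘-additive : ∀ {n a b} → (a + b) ^ p ≡[𝔐^ n ] a ^ p + b ^ p → ℘ (a + b) ≡[𝔐^ n ] ℘ a + ℘ b
  ℘-additive {n} {a} {b} frob = begin
    (a + b) ^ p - (a + b)     ≈⟨ +-cong-≡[𝔐^] frob (≈⇒≡[𝔐^] refl) ⟩
    (a ^ p + b ^ p) - (a + b) ≈⟨ ≈⇒≡[𝔐^] ([x+y]-[z+w]≈[x-z]+[y-w] _ _ _ _) ⟩
    ℘ a + ℘ b                 ∎
    where open ≡[𝔐^]-Reasoning n

  p≡2+[p∸2] : p ≡ 2 ℕ.+ (p ∸ 2)
  p≡2+[p∸2] = prime⇒≡2+∸2 p-prime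

  fermat : ∀ m → ℘ (ℕ→R m) ∈𝔐^ 1ℤ
  fermat zero    = ∈𝔐^-resp-≈ (sym ℘0≈0) 0∈𝔐^
    where
    ℘0≈0 : ℘ 0# ≈ 0#
    ℘0≈0 = trans (+-congʳ (≡.subst (λ n → 0# ^ n ≈ 0#) (≡.sym p≡2+[p∸2]) (zeroˡ _)))
                 (-‿inverseʳ 0#)
  fermat (suc m) = ∈𝔐^-resp-≡[𝔐^] (℘-additive frob) (+-∈𝔐^ ℘1∈𝔐 (fermat m))
    where
    frob : (1# + ℕ→R m) ^ p ≡[𝔐^ 1ℤ ] 1# ^ p + ℕ→R m ^ p
    frob = ≡.subst (λ n → (1# + ℕ→R m) ^ p ≡[𝔐^ n ] 1# ^ p + ℕ→R m ^ p)
      (≡.cong₂ (λ x y → 1ℤ ℤ.+ (x ℤ.+ y)) (ℤP.*-zeroʳ (+ (p ∸ 1))) (ℤP.*-zeroʳ (+ (p ∸ 1))))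
      (frobenius p-prime p∈𝔐 1∈𝔐^0 (ℕ→R-∈𝔐^0 m) ℤP.≤-refl ℤP.≤-refl)
    1^n≈1 : ∀ n → 1# ^ n ≈ 1#
    1^n≈1 zero    = refl
    1^n≈1 (suc n) = trans (*-identityˡ _) (1^n≈1 n)
    ℘1∈𝔐 : ℘ 1# ∈𝔐^ 1ℤ
    ℘1∈𝔐 = ∈𝔐^-resp-≈ (sym (trans (+-congʳ (1^n≈1 p)) (-‿inverseʳ 1#))) 0∈𝔐^

  fallingFactorial : ℕ → Carrier → Carrier
  fallingFactorial zero    y = 1#
  fallingFactorial (suc m) y = fallingFactorial m y * (y - ℕ→R m)

  fallingFactorial-∈𝔐^0 : ∀ m {y} → y ∈𝔐^ 0ℤ → fallingFactorial m y ∈𝔐^ 0ℤ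
  fallingFactorial-∈𝔐^0 zero    _  = 1∈𝔐^0
  fallingFactorial-∈𝔐^0 (suc m) y∈ =
    *-∈𝔐^ (fallingFactorial-∈𝔐^0 m y∈) (-∈𝔐^ y∈ (ℕ→R-∈𝔐^0 m))

  v-fallingFactorial : ∀ {k m} → k ℕ.≤ m → m ℕ.< p → v (fallingFactorial k (ℕ→R m)) ≡ fin 0ℤ
  v-fallingFactorial {zero}      _   _   = v-1
  v-fallingFactorial {suc k} {m} k<m m<p =
    ≡.trans (v-mul _ _) (≡.cong₂ _+∞_ (v-fallingFactorial (ℕP.<⇒≤ k<m) m<p) v[m-k]≡0)
    where
    m-k≈m∸k : ℕ→R m - ℕ→R k ≈ ℕ→R (m ∸ k)
    m-k≈m∸k = begin
      ℕ→R m - ℕ→R k                 ≡⟨ ≡.cong (λ n → ℕ→R n - ℕ→R k) (≡.sym (ℕP.m∸n+n≡m (ℕP.<⇒≤ k<m))) ⟩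
      ℕ→R (m ∸ k ℕ.+ k) - ℕ→R k     ≈⟨ +-congʳ (ℕ→R-+ (m ∸ k) k) ⟩
      (ℕ→R (m ∸ k) + ℕ→R k) - ℕ→R k ≈⟨ //-rightDividesʳ (ℕ→R k) (ℕ→R (m ∸ k)) ⟩
      ℕ→R (m ∸ k)                   ∎
      where open ≈-Reasoning
    v[m-k]≡0 : v (ℕ→R m - ℕ→R k) ≡ fin 0ℤ
    v[m-k]≡0 = ≡.trans (v-cong m-k≈m∸k)
      (ℕ→R-unit (ℕP.m<n⇒0<n∸m k<m) (ℕP.≤-<-trans (ℕP.m∸n≤m m k) m<p))

  fallingFactorial∈𝔐⇒root : ∀ m {y} → y ∈𝔐^ 0ℤ → fallingFactorial m y ∈𝔐^ 1ℤ →
                             ∃ λ k → y ≡[𝔐^ 1ℤ ] ℕ→R k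
  fallingFactorial∈𝔐⇒root zero    _  1∈𝔐 = contradiction 1∈𝔐 1∉𝔐
  fallingFactorial∈𝔐⇒root (suc m) y∈ f∈
    with 𝔐-prime (fallingFactorial-∈𝔐^0 m y∈) (-∈𝔐^ y∈ (ℕ→R-∈𝔐^0 m)) f∈
  ... | inj₁ fm∈  = fallingFactorial∈𝔐⇒root m y∈ fm∈
  ... | inj₂ y-m∈ = m , y-m∈

  ℘-monic : Monic p ℘
  ℘-monic = ≡.subst (λ n → Monic n (λ x → x ^ n - x)) (≡.sym p≡2+[p∸2]) (x^[2+r]-x-monic (p ∸ 2))

  -- Synthetic division by y - m for m = 0, …, p - 1: the remainder f m lies in 𝔐 because
  -- ℘ m ∈ 𝔐 (fermat) and fallingFactorial m m = m! is a unit.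
  ℘-factorisation : ∀ m d → m ℕ.+ d ≡ p →
    ∃ λ f → Monic d f × (∀ y → y ∈𝔐^ 0ℤ → ℘ y ≡[𝔐^ 1ℤ ] fallingFactorial m y * f y)
  ℘-factorisation zero    d d≡p = ℘ , ≡.subst (λ n → Monic n ℘) (≡.sym d≡p) ℘-monic ,
    λ y _ → ≈⇒≡[𝔐^] (sym (*-identityˡ (℘ y)))
  ℘-factorisation (suc m) d 1+m+d≡p
    with ℘-factorisation m (suc d) (≡.trans (ℕP.+-suc m d) 1+m+d≡p)
  ... | f , f-monic , ℘≡falling*f with divide f-monic (ℕ→R m)
  ...   | g , g-monic , f≈ = g , g-monic , ℘≡falling*g
    where
    M : Carrier
    M = ℕ→R m
    m<p : m ℕ.< p
    m<p = ≡.subst (m ℕ.<_) 1+m+d≡p (ℕP.m≤m+n (suc m) d)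
    fM∈𝔐 : f M ∈𝔐^ 1ℤ
    fM∈𝔐 = unit-cancelˡ (v-fallingFactorial ℕP.≤-refl m<p)
      (∈𝔐^-resp-≡[𝔐^] (≡[𝔐^]-sym (℘≡falling*f M (ℕ→R-∈𝔐^0 m))) (fermat m))
    ℘≡falling*g : ∀ y → y ∈𝔐^ 0ℤ → ℘ y ≡[𝔐^ 1ℤ ] fallingFactorial (suc m) y * g y
    ℘≡falling*g y y∈ = begin
      ℘ y                                          ≈⟨ ℘≡falling*f y y∈ ⟩
      fallingFactorial m y * f y                   ≈⟨ ≈⇒≡[𝔐^] (*-congˡ (f≈ y)) ⟩
      fallingFactorial m y * ((y - M) * g y + f M) ≈⟨ *-congˡ-≡[𝔐^] (fallingFactorial-∈𝔐^0 m y∈)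
                                                                    (+-absorbʳ fM∈𝔐) ⟩
      fallingFactorial m y * ((y - M) * g y)       ≈⟨ ≈⇒≡[𝔐^] (sym (*-assoc _ _ _)) ⟩
      fallingFactorial (suc m) y * g y             ∎
      where open ≡[𝔐^]-Reasoning 1ℤ

  ℘[y]∈𝔐⇒y≡k : ∀ {y} → y ∈𝔐^ 0ℤ → ℘ y ∈𝔐^ 1ℤ → ∃ λ k → y ≡[𝔐^ 1ℤ ] ℕ→R k
  ℘[y]∈𝔐⇒y≡k {y} y∈ ℘y∈ with ℘-factorisation p 0 (ℕP.+-identityʳ p)
  ... | f , one f≈1 , ℘≡falling*f = fallingFactorial∈𝔐⇒root p y∈
    (∈𝔐^-resp-≈ (trans (*-congˡ (f≈1 y)) (*-identityʳ _))
      (∈𝔐^-resp-≡[𝔐^] (≡[𝔐^]-sym (℘≡falling*f y y∈)) ℘y∈))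

  ℘-cancelˡ : ∀ {u t α γ} → α ∈𝔐^ ℤ.- + u → γ ∈𝔐^ t → t ℤ.≤ 0ℤ →
              ℕ→R p ∈𝔐^ ℤ.suc (+ (u ℕ.* (p ∸ 1))) → ℘ (α + γ) ≡[𝔐^ 1ℤ ] ℘ α →
              ℘ γ ∈𝔐^ 1ℤ ℤ.+ + (p ∸ 1) ℤ.* t
  ℘-cancelˡ {u} {t} {α} {γ} α∈ γ∈ t≤0 p∈ ℘[α+γ]≡℘α = +-absorbʳ⁻¹ (begin
    ℘ α + ℘ γ ≈⟨ ≡[𝔐^]-sym ℘[α+γ]≡℘α+℘γ ⟩
    ℘ (α + γ) ≈⟨ ∈𝔐^-weaken (ℤP.+-monoʳ-≤ 1ℤ (nonNeg*nonPos≤0 (p ∸ 1) t≤0)) ℘[α+γ]≡℘α ⟩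
    ℘ α       ∎)
    where
    open ≡[𝔐^]-Reasoning (1ℤ ℤ.+ + (p ∸ 1) ℤ.* t)
    ℘[α+γ]≡℘α+℘γ : ℘ (α + γ) ≡[𝔐^ 1ℤ ℤ.+ + (p ∸ 1) ℤ.* t ] ℘ α + ℘ γ
    ℘[α+γ]≡℘α+℘γ = ≡.subst (λ n → ℘ (α + γ) ≡[𝔐^ n ] ℘ α + ℘ γ) (1+uq+[q*-u+q*t]≡1+q*t u (p ∸ 1) t)
      (℘-additive (frobenius p-prime p∈ α∈ γ∈ ℤP.neg-≤-pos t≤0))

  ℘-∉𝔐^-negative : ∀ {n x} → v x ≡ fin n → n ℤ.< 0ℤ → ¬ ℘ x ∈𝔐^ 1ℤ ℤ.+ + (p ∸ 1) ℤ.* n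
  ℘-∉𝔐^-negative {n} {x} vx≡n n<0 ℘x∈ = v≡⇒∉𝔐^suc (v-^ p vx≡n)
    (∈𝔐^-resp-≈ (//-rightDividesˡ x (x ^ p))
      (+-∈𝔐^ (∈𝔐^-weaken 1+pn≤1+qn ℘x∈) (∈𝔐^-weaken 1+pn≤n (v≡⇒∈𝔐^ vx≡n))))
    where
    1+pn≤1+qn : 1ℤ ℤ.+ + p ℤ.* n ℤ.≤ 1ℤ ℤ.+ + (p ∸ 1) ℤ.* n
    1+pn≤1+qn = ≡.subst (λ P → 1ℤ ℤ.+ + P ℤ.* n ℤ.≤ 1ℤ ℤ.+ + (P ∸ 1) ℤ.* n) (≡.sym p≡2+[p∸2])
      (1+[1+q]n≤1+qn (suc (p ∸ 2)) (ℤP.<⇒≤ n<0))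
    1+pn≤n : 1ℤ ℤ.+ + p ℤ.* n ℤ.≤ n
    1+pn≤n = ≡.subst (λ P → 1ℤ ℤ.+ + P ℤ.* n ℤ.≤ n) (≡.sym p≡2+[p∸2]) (1+[2+q]n≤n (p ∸ 2) n<0)

  ∈𝔐^0⊎negative : ∀ x → x ∈𝔐^ 0ℤ ⊎ ∃ λ n → v x ≡ fin n × n ℤ.< 0ℤ
  ∈𝔐^0⊎negative x with v x
  ... | ∞            = inj₁ x≤∞
  ... | fin (+ _)    = inj₁ (fin≤fin (ℤ.+≤+ ℕ.z≤n))
  ... | fin -[1+ k ] = inj₂ (-[1+ k ] , ≡.refl , ℤ.-<+)

  ℘β≡℘α⇒β≡α+k : ∀ {u α β} → v α ≡ fin (ℤ.- + u) → ℕ→R p ∈𝔐^ ℤ.suc (+ (u ℕ.* (p ∸ 1))) →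
                 ℘ β ≡[𝔐^ 1ℤ ] ℘ α → ∃ λ k → β ≡[𝔐^ 1ℤ ] α + ℕ→R k
  ℘β≡℘α⇒β≡α+k {u} {α} {β} vα≡-u p∈ ℘β≡℘α =
    proj₁ γ≡k , ≡[𝔐^]-trans (≈⇒≡[𝔐^] (sym α+γ≈β)) (+-cong-≡[𝔐^] (≈⇒≡[𝔐^] refl) (proj₂ γ≡k))
    where
    γ : Carrier
    γ = β - α
    α+γ≈β : α + γ ≈ β
    α+γ≈β = trans (+-comm α γ) (//-rightDividesˡ α β)
    ℘γ∈ : ∀ {t} → γ ∈𝔐^ t → t ℤ.≤ 0ℤ → ℘ γ ∈𝔐^ 1ℤ ℤ.+ + (p ∸ 1) ℤ.* t
    ℘γ∈ γ∈ t≤0 = ℘-cancelˡ (v≡⇒∈𝔐^ vα≡-u) γ∈ t≤0 p∈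
      (∈𝔐^-resp-≈ (+-congʳ (℘-cong (sym α+γ≈β))) ℘β≡℘α)
    γ-integral : γ ∈𝔐^ 0ℤ
    γ-integral with ∈𝔐^0⊎negative γ
    ... | inj₁ γ∈               = γ∈
    ... | inj₂ (n , vγ≡n , n<0) =
      contradiction (℘γ∈ (v≡⇒∈𝔐^ vγ≡n) (ℤP.<⇒≤ n<0)) (℘-∉𝔐^-negative vγ≡n n<0)
    ℘γ∈𝔐 : ℘ γ ∈𝔐^ 1ℤ
    ℘γ∈𝔐 = ≡.subst (℘ γ ∈𝔐^_) (≡.cong ℤ.suc (ℤP.*-zeroʳ (+ (p ∸ 1)))) (℘γ∈ γ-integral ℤP.≤-refl)
    γ≡k : ∃ λ k → γ ≡[𝔐^ 1ℤ ] ℕ→R k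
    γ≡k = ℘[y]∈𝔐⇒y≡k γ-integral ℘γ∈𝔐

proposition3p3 : {c ℓ : Level} (L : LocalField c ℓ) →
    let open LocalField L in
    (α β : Carrier) (u : ℕ) →
    v α ≡ fin (ℤ.- (+ u)) → 0 ℕ.< u → fin (+ (u ℕ.* (p ℕ.∸ 1))) <∞ e →
    ((β ^ p) - β) ≡[𝔐] ((α ^ p) - α) →
    ∃ λ (k : ℤ) → β ≡[𝔐] (α + ℤ→R k)
proposition3p3 L α β u vα≡-u _ u[p-1]<e ℘β≡℘α = + proj₁ shift , suc≤∞⇒<∞ (proj₂ shift)
  where
  open LocalField L
  open Valuation L
  open ArtinSchreier L
  shift : ∃ λ k → β ≡[𝔐^ 1ℤ ] α + ℕ→R k
  shift = ℘β≡℘α⇒β≡α+k {u} {α} {β} vα≡-u (<∞⇒suc≤∞ u[p-1]<e) (<∞⇒suc≤∞ ℘β≡℘α)
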